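{- Let $\alpha=(\alpha_1,\alpha_2,\dots)$ and $\beta=(\beta_0,\beta_1,\dots)$ be sequences of positive numbers and let $\zeta_{nk}=\zeta_{nk}(\alpha,\beta)$ be the Euler polynomials generated by them. Then for $n\in\mathbf N$ and $0\le k\le n$, $$\zeta_{nk}=\zeta_{n-1,k-1}\,\alpha_{n-k+1}+\zeta_{n-1,k}\,\beta_k .$$
   Context: For $\omega=(\varepsilon_1,\dots,\varepsilon_n)\in\{0,1\}^n$, $w_n(\omega)=\prod_{m=1}^ng_m$ where, with $k_m=\#\{l<m:\varepsilon_l=0\}$, $g_m=\alpha_{m-k_m}$ if $\varepsilon_m=0$ and $g_m=\beta_{k_m}$ if $\varepsilon_m=1$. For $n\ge1$, $0\le k\le n$, $\zeta_{nk}(\alpha,\beta)=\sum w_n(\omega)$ over $\omega$ with exactly $k$ zeros; $\zeta_{00}=1$ and $\zeta_{nk}=0$ if $k<0$ or $k>n$. -}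

module Defs where

open import Level using (Level)
open import Algebra.Bundles using (CommutativeSemiring)
open import Data.Bool using (Bool; true; false; not)
open import Data.Nat using (ℕ; zero; suc; _∸_; _≟_)
open import Data.Integer using (ℤ; +_; -[1+_])
open import Data.List using (List; []; _∷_; map; _++_; filter; length; foldr)

-- All words ω = (ε₁,…,εₙ) ∈ {0,1}ⁿ, encoded as lists of Bool of length n;
-- convention: false ↔ ε = 0, true ↔ ε = 1.
words : ℕ → List (List Bool)
words zero    = [] ∷ []
words (suc n) = map (false ∷_) (words n) ++ map (true ∷_) (words n)

zeros : List Bool → ℕ
zeros ω = length (filter (λ b → b Data.Bool.≟ false) ω)

module Euler {c ℓ : Level} (R : CommutativeSemiring c ℓ) where
  open CommutativeSemiring R

  -- wAux i k ω : product of g_m over the remaining letters, where i letters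
  -- have been read so far (so the next letter is number m = i+1) and k of
  -- them were zeros (k = k_m).
  --   ε_m = 0 : g_m = α_{m - k_m}
  --   ε_m = 1 : g_m = β_{k_m}
  wAux : (ℕ → Carrier) → (ℕ → Carrier) → ℕ → ℕ → List Bool → Carrier
  wAux α β i k []            = 1#
  wAux α β i k (false ∷ ω)   = α (suc i ∸ k) * wAux α β (suc i) (suc k) ω
  wAux α β i k (true ∷ ω)    = β k * wAux α β (suc i) k ω

  w : (ℕ → Carrier) → (ℕ → Carrier) → List Bool → Carrier
  w α β ω = wAux α β 0 0 ω

  sumList : List Carrier → Carrier
  sumList = foldr _+_ 0#

  ζℕ : (ℕ → Carrier) → (ℕ → Carrier) → ℕ → ℕ → Carrier
  ζℕ α β n k = sumList (map (w α β) (filter (λ ω → zeros ω ≟ k) (words n)))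

  ζ : (ℕ → Carrier) → (ℕ → Carrier) → ℕ → ℤ → Carrier
  ζ α β n (+ k)     = ζℕ α β n k
  ζ α β n -[1+ k ]  = 0#

-- Words are built by prepending letters, so ζ unfolds naturally along the
-- first letter, while the recurrence splits off the last one.  Generalising ζ
-- to words read from an arbitrary state (i letters already read, j of them
-- zeros) gives a first-letter recurrence, and the last-letter recurrence then
-- follows by induction on n: the factor contributed by the last letter depends
-- only on its position and on the number of zeros before it, not on how the
-- first letter was chosen.
module Submission where

open import Defs
open import Level using (Level)
open import Algebra.Bundles using (CommutativeSemiring)
open import Data.Nat using (ℕ; zero; suc; _∸_; _≤_; s≤s; _≟_; _≡ᵇ_)
open import Data.Integer using (+_; _-_; 1ℤ)
import Data.Nat.Properties as ℕ
open import Data.Bool using (Bool; true; false)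
open import Data.List using (List; []; _∷_; map; _++_; filter)
open import Relation.Binary.PropositionalEquality as ≡ using (_≡_; cong; cong₂)

module EulerRecurrence {c ℓ : Level} (R : CommutativeSemiring c ℓ)
                       (α β : ℕ → CommutativeSemiring.Carrier R) where
  open CommutativeSemiring R hiding (zero)
  open Data.Nat using () renaming (_+_ to _+ℕ_)
  open Euler R
  open import Relation.Binary.Reasoning.Setoid setoid
  open import Algebra.Solver.Ring.NaturalCoefficients.Default R

  weightSum : ℕ → ℕ → ℕ → List (List Bool) → Carrier
  weightSum i j k L = sumList (map (wAux α β i j) (filter (λ ω → zeros ω ≟ k) L))

  weightSum-++ : ∀ i j k xs ys →
                 weightSum i j k (xs ++ ys) ≈ weightSum i j k xs + weightSum i j k ys
  weightSum-++ i j k []       ys = sym (+-identityˡ _)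
  weightSum-++ i j k (x ∷ xs) ys with zeros x ≡ᵇ k
  ... | true  = trans (+-congˡ (weightSum-++ i j k xs ys)) (sym (+-assoc _ _ _))
  ... | false = weightSum-++ i j k xs ys

  weightSum-false∷-zero : ∀ i j L → weightSum i j 0 (map (false ∷_) L) ≈ 0#
  weightSum-false∷-zero i j []      = refl
  weightSum-false∷-zero i j (x ∷ L) = weightSum-false∷-zero i j L

  weightSum-false∷ : ∀ i j k L → weightSum i j (suc k) (map (false ∷_) L)
                                 ≈ α (suc i ∸ j) * weightSum (suc i) (suc j) k L
  weightSum-false∷ i j k []      = sym (zeroʳ _)
  weightSum-false∷ i j k (x ∷ L) with zeros x ≡ᵇ k
  ... | true  = trans (+-congˡ (weightSum-false∷ i j k L)) (sym (distribˡ _ _ _))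
  ... | false = weightSum-false∷ i j k L

  weightSum-true∷ : ∀ i j k L → weightSum i j k (map (true ∷_) L)
                                ≈ β j * weightSum (suc i) j k L
  weightSum-true∷ i j k []      = sym (zeroʳ _)
  weightSum-true∷ i j k (x ∷ L) with zeros x ≡ᵇ k
  ... | true  = trans (+-congˡ (weightSum-true∷ i j k L)) (sym (distribˡ _ _ _))
  ... | false = weightSum-true∷ i j k L

  ζFrom : ℕ → ℕ → ℕ → ℕ → Carrier
  ζFrom i j zero    zero    = 1#
  ζFrom i j zero    (suc k) = 0#
  ζFrom i j (suc n) zero    = β j * ζFrom (suc i) j n zero
  ζFrom i j (suc n) (suc k) = α (suc i ∸ j) * ζFrom (suc i) (suc j) n k
                            + β j * ζFrom (suc i) j n (suc k)

  weightSum-words : ∀ n i j k → weightSum i j k (words n) ≈ ζFrom i j n k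
  weightSum-words zero    i j zero    = +-identityʳ _
  weightSum-words zero    i j (suc k) = refl
  weightSum-words (suc n) i j zero    = begin
    weightSum i j 0 (map (false ∷_) (words n) ++ map (true ∷_) (words n))
      ≈⟨ weightSum-++ i j 0 (map (false ∷_) (words n)) (map (true ∷_) (words n)) ⟩
    weightSum i j 0 (map (false ∷_) (words n)) + weightSum i j 0 (map (true ∷_) (words n))
      ≈⟨ +-cong (weightSum-false∷-zero i j (words n)) (weightSum-true∷ i j 0 (words n)) ⟩
    0# + β j * weightSum (suc i) j 0 (words n)
      ≈⟨ +-identityˡ _ ⟩
    β j * weightSum (suc i) j 0 (words n)
      ≈⟨ *-congˡ (weightSum-words n (suc i) j 0) ⟩
    ζFrom i j (suc n) zero ∎
  weightSum-words (suc n) i j (suc k) = begin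
    weightSum i j (suc k) (map (false ∷_) (words n) ++ map (true ∷_) (words n))
      ≈⟨ weightSum-++ i j (suc k) (map (false ∷_) (words n)) (map (true ∷_) (words n)) ⟩
    weightSum i j (suc k) (map (false ∷_) (words n)) + weightSum i j (suc k) (map (true ∷_) (words n))
      ≈⟨ +-cong (weightSum-false∷ i j k (words n)) (weightSum-true∷ i j (suc k) (words n)) ⟩
    α (suc i ∸ j) * weightSum (suc i) (suc j) k (words n) + β j * weightSum (suc i) j (suc k) (words n)
      ≈⟨ +-cong (*-congˡ (weightSum-words n (suc i) (suc j) k))
                (*-congˡ (weightSum-words n (suc i) j (suc k))) ⟩
    ζFrom i j (suc n) (suc k) ∎

  ζFrom-snoc-one : ∀ n i j → ζFrom i j (suc n) 0 ≈ ζFrom i j n 0 * β j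
  ζFrom-snoc-one zero    i j = *-comm _ _
  ζFrom-snoc-one (suc n) i j =
    trans (*-congˡ (ζFrom-snoc-one n (suc i) j)) (sym (*-assoc _ _ _))

  regroup-single : ∀ a b x y z p q →
    a * (x * q) + b * (y * p + z * q) ≈ (b * y) * p + (a * x + b * z) * q
  regroup-single = solve 7 (λ a b x y z p q →
    a :* (x :* q) :+ b :* (y :* p :+ z :* q) := (b :* y) :* p :+ (a :* x :+ b :* z) :* q) refl

  regroup : ∀ a b x y z w p q →
    a * (x * p + y * q) + b * (z * p + w * q) ≈ (a * x + b * z) * p + (a * y + b * w) * q
  regroup = solve 8 (λ a b x y z w p q →
    a :* (x :* p :+ y :* q) :+ b :* (z :* p :+ w :* q) := (a :* x :+ b :* z) :* p :+ (a :* y :+ b :* w) :* q) refl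

  -- a and b are the indices of the last letter's factor; abstracting them lets
  -- both first-letter branches reach the same a and b, up to +-suc.
  ζFrom-snoc : ∀ n i j k {a b} → suc (n +ℕ i) ∸ (k +ℕ j) ≡ a → suc k +ℕ j ≡ b →
               ζFrom i j (suc n) (suc k) ≈ ζFrom i j n k * α a + ζFrom i j n (suc k) * β b
  ζFrom-snoc zero    i j zero    ≡.refl ≡.refl = solve 3 (λ a b c →
    a :* con 1 :+ b :* con 0 := con 1 :* a :+ con 0 :* c) refl _ _ _
  ζFrom-snoc zero    i j (suc k) ≡.refl ≡.refl = solve 4 (λ a b x y →
    a :* con 0 :+ b :* con 0 := con 0 :* x :+ con 0 :* y) refl _ _ _ _
  ζFrom-snoc (suc n) i j zero    ≡.refl ≡.refl =
    trans (+-cong (*-congˡ (ζFrom-snoc-one n (suc i) (suc j)))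
                  (*-congˡ (ζFrom-snoc n (suc i) j zero
                              (cong (λ m → suc m ∸ j) (ℕ.+-suc n i)) ≡.refl)))
          (regroup-single _ _ _ _ _ _ _)
  ζFrom-snoc (suc n) i j (suc k) ≡.refl ≡.refl =
    trans (+-cong (*-congˡ (ζFrom-snoc n (suc i) (suc j) k
                              (cong₂ (λ m l → suc m ∸ l) (ℕ.+-suc n i) (ℕ.+-suc k j))
                              (cong suc (ℕ.+-suc k j))))
                  (*-congˡ (ζFrom-snoc n (suc i) j (suc k)
                              (cong (λ m → suc m ∸ suc (k +ℕ j)) (ℕ.+-suc n i)) ≡.refl)))
          (regroup _ _ _ _ _ _ _ _)

  ζℕ-snoc-one : ∀ n → ζℕ α β (suc n) 0 ≈ ζℕ α β n 0 * β 0
  ζℕ-snoc-one n = begin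
    ζℕ α β (suc n) 0   ≈⟨ weightSum-words (suc n) 0 0 0 ⟩
    ζFrom 0 0 (suc n) 0 ≈⟨ ζFrom-snoc-one n 0 0 ⟩
    ζFrom 0 0 n 0 * β 0 ≈⟨ *-congʳ (weightSum-words n 0 0 0) ⟨
    ζℕ α β n 0 * β 0   ∎

  ζℕ-snoc : ∀ n k → k ≤ n →
            ζℕ α β (suc n) (suc k) ≈ ζℕ α β n k * α (suc (n ∸ k)) + ζℕ α β n (suc k) * β (suc k)
  ζℕ-snoc n k k≤n = begin
    ζℕ α β (suc n) (suc k)
      ≈⟨ weightSum-words (suc n) 0 0 (suc k) ⟩
    ζFrom 0 0 (suc n) (suc k)
      ≈⟨ ζFrom-snoc n 0 0 k
           (≡.trans (cong₂ (λ m l → suc m ∸ l) (ℕ.+-identityʳ n) (ℕ.+-identityʳ k))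
                    (ℕ.+-∸-assoc 1 k≤n))
           (cong suc (ℕ.+-identityʳ k)) ⟩
    ζFrom 0 0 n k * α (suc (n ∸ k)) + ζFrom 0 0 n (suc k) * β (suc k)
      ≈⟨ +-cong (*-congʳ (weightSum-words n 0 0 k)) (*-congʳ (weightSum-words n 0 0 (suc k))) ⟨
    ζℕ α β n k * α (suc (n ∸ k)) + ζℕ α β n (suc k) * β (suc k) ∎

theorem6p1 : ∀ {c ℓ : Level} (R : CommutativeSemiring c ℓ) →
    let open CommutativeSemiring R
        open Euler R
    in (α β : ℕ → Carrier) (n k : ℕ) → 1 Data.Nat.≤ n → k ≤ n →
       ζ α β n (+ k) ≈ (ζ α β (n ∸ 1) (+ k - 1ℤ) * α (suc (n ∸ k)) + ζ α β (n ∸ 1) (+ k) * β k)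
theorem6p1 R α β (suc n) zero    _ _ =
  trans (ζℕ-snoc-one n) (sym (trans (+-congʳ (zeroˡ _)) (+-identityˡ _)))
  where open CommutativeSemiring R hiding (zero)
        open EulerRecurrence R α β
theorem6p1 R α β (suc n) (suc k) _ (s≤s k≤n) = ζℕ-snoc n k k≤n
  where open EulerRecurrence R α β
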